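{- For every non-negative integer $n$ and every integer $s$, \[ \sum_{k = 0}^{\lfloor n/2 \rfloor } \binom n{2k}5^k F_{6k + s} = 2^{n - 1}\big(2^n F_{2n + s} + (- 1)^n F_{3n + s}\big),\qquad \sum_{k = 0}^{\lfloor n/2 \rfloor } \binom n{2k}5^k L_{6k + s} = 2^{n - 1} \big(2^n L_{2n + s} + (- 1)^n L_{3n + s}\big). \]
   Context: The Fibonacci numbers $F_j$ and Lucas numbers $L_j$ are defined for all integers $j$ by $F_0=0$, $F_1=1$, $L_0=2$, $L_1=1$, $F_j=F_{j-1}+F_{j-2}$, $L_j=L_{j-1}+L_{j-2}$, with $F_{ -j}=(-1)^{j-1}F_j$ and $L_{ -j}=(-1)^jL_j$. -}

module Defs where

open import Data.Nat as ℕ using (ℕ; zero; suc)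
open import Data.Integer using (ℤ; +_; -[1+_]; _+_; _*_; -_; _^_)

fibℕ : ℕ → ℤ
fibℕ 0 = + 0
fibℕ 1 = + 1
fibℕ (suc (suc n)) = fibℕ (suc n) + fibℕ n

lucℕ : ℕ → ℤ
lucℕ 0 = + 2
lucℕ 1 = + 1
lucℕ (suc (suc n)) = lucℕ (suc n) + lucℕ n

sgn : ℕ → ℤ
sgn j = (- (+ 1)) ^ j

-- Extension to all integers: F_{-j} = (-1)^{j-1} F_j, L_{-j} = (-1)^j L_j
F : ℤ → ℤ
F (+ n) = fibℕ n
F -[1+ n ] = sgn n * fibℕ (suc n)

L : ℤ → ℤ
L (+ n) = lucℕ n
L -[1+ n ] = sgn (suc n) * lucℕ (suc n)

sumTo : ℕ → (ℕ → ℤ) → ℤ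
sumTo zero f = f zero
sumTo (suc m) f = sumTo m f + f (suc m)

-- Integer sequences G satisfying the Fibonacci recurrence form a module over ℤ[φ] (φ² = φ + 1),
-- φ acting as the shift G ↦ G (· + 1).  For a = √5 φ³ we have a² = 5 φ⁶, so the k-th summand is
-- C(n,2k) a²ᵏ applied to G at s.  In any ring 2 Σₖ C(n,2k) a²ᵏ = (1 + a)ⁿ + (1 - a)ⁿ, and here
-- 1 + a = 4 φ² and 1 - a = -2 φ³, which applied to G give 4ⁿ G(2n + s) + (-2)ⁿ G(3n + s).

module Submission where

open import Algebra using (Ring)
open import Data.Nat as ℕ using (ℕ; zero; suc; _<_; _≤′_; _/_)
open import Data.Nat.Combinatorics using (_C_; nCk+nC[k+1]≡[n+1]C[k+1]; k>n⇒nCk≡0)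
open import Data.Nat.DivMod using (m*n/n≡m; /-monoˡ-≤; m/n≤m)
open import Data.Product using (_,_; proj₁)
open import Function using (_∘_)
open import Level using (Level; 0ℓ)
import Data.Nat.Properties as ℕ
import Relation.Binary.PropositionalEquality as ≡

half<⇒<double : ∀ {n k} → n / 2 < k → n < 2 ℕ.* k
half<⇒<double {n} {k} n/2<k = ℕ.≰⇒> λ 2k≤n → ℕ.<⇒≱ n/2<k
  (≡.subst (ℕ._≤ n / 2) (m*n/n≡m k 2) (/-monoˡ-≤ 2 (≡.subst (ℕ._≤ n) (ℕ.*-comm 2 k) 2k≤n)))

module BinomialParity {c ℓ : Level} (R : Ring c ℓ) where

  open Ring R hiding (zero)
  open import Algebra.Definitions.RawMonoid +-rawMonoid using (_×_)
  open import Algebra.Properties.Semiring.Exp semiring using (_^_)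
  open import Algebra.Properties.Monoid.Mult +-monoid using (×-congˡ; ×-homo-+)
  open import Algebra.Properties.Semiring.Mult semiring using (×-comm-*)
  open import Algebra.Properties.AbelianGroup +-abelianGroup using (ε⁻¹≈ε; ⁻¹-anti-homo‿-; ⁻¹-∙-comm)
  open import Algebra.Properties.CommutativeSemigroup +-commutativeSemigroup using (interchange)
  open import Algebra.Properties.Ring R using ([y-z]x≈yx-zx; x[y-z]≈xy-xz)
  open import Relation.Binary.Reasoning.Setoid setoid

  ∑≤ : ℕ → (ℕ → Carrier) → Carrier
  ∑≤ zero    f = f zero
  ∑≤ (suc m) f = ∑≤ m f + f (suc m)

  ∑≤-cong : ∀ m {f g : ℕ → Carrier} → (∀ k → f k ≈ g k) → ∑≤ m f ≈ ∑≤ m g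
  ∑≤-cong zero    f≈g = f≈g zero
  ∑≤-cong (suc m) f≈g = +-cong (∑≤-cong m f≈g) (f≈g (suc m))

  ∑≤-distrib-+ : ∀ m (f g : ℕ → Carrier) → ∑≤ m (λ k → f k + g k) ≈ ∑≤ m f + ∑≤ m g
  ∑≤-distrib-+ zero    f g = refl
  ∑≤-distrib-+ (suc m) f g = trans (+-congʳ (∑≤-distrib-+ m f g))
    (interchange (∑≤ m f) (∑≤ m g) (f (suc m)) (g (suc m)))

  *-distribˡ-∑≤ : ∀ m x (f : ℕ → Carrier) → x * ∑≤ m f ≈ ∑≤ m (λ k → x * f k)
  *-distribˡ-∑≤ zero    x f = refl
  *-distribˡ-∑≤ (suc m) x f = trans (distribˡ x (∑≤ m f) (f (suc m))) (+-congʳ (*-distribˡ-∑≤ m x f))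

  ∑≤-suc-head : ∀ m (f : ℕ → Carrier) → ∑≤ (suc m) f ≈ f 0 + ∑≤ m (f ∘ suc)
  ∑≤-suc-head zero    f = refl
  ∑≤-suc-head (suc m) f = trans (+-congʳ (∑≤-suc-head m f)) (+-assoc (f 0) _ _)

  ∑≤-vanishing-tail : ∀ {m n} (f : ℕ → Carrier) → m ≤′ n → (∀ k → m < k → f k ≈ 0#) →
                      ∑≤ n f ≈ ∑≤ m f
  ∑≤-vanishing-tail f ℕ.≤′-refl f≈0 = refl
  ∑≤-vanishing-tail {m} {suc n} f (ℕ.≤′-step m≤′n) f≈0 = begin
    ∑≤ n f + f (suc n) ≈⟨ +-congˡ (f≈0 (suc n) (ℕ.s≤s (ℕ.≤′⇒≤ m≤′n))) ⟩
    ∑≤ n f + 0#        ≈⟨ +-identityʳ (∑≤ n f) ⟩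
    ∑≤ n f             ≈⟨ ∑≤-vanishing-tail f m≤′n f≈0 ⟩
    ∑≤ m f             ∎

  binomialTerm : ℕ → ℕ → Carrier → Carrier
  binomialTerm n j a = (n C j) × a ^ j

  binomialTerm-vanishes : ∀ {n j} a → n < j → binomialTerm n j a ≈ 0#
  binomialTerm-vanishes a n<j = ×-congˡ (k>n⇒nCk≡0 n<j)

  binomialTerm-pascal : ∀ n j a →
    binomialTerm (suc n) (suc j) a ≈ a * binomialTerm n j a + binomialTerm n (suc j) a
  binomialTerm-pascal n j a = begin
    (suc n C suc j) × (a * a ^ j)                       ≈⟨ ×-congˡ (nCk+nC[k+1]≡[n+1]C[k+1] n j) ⟨
    (n C j ℕ.+ n C suc j) × (a * a ^ j)                 ≈⟨ ×-homo-+ (a * a ^ j) (n C j) (n C suc j) ⟩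
    (n C j) × (a * a ^ j) + (n C suc j) × (a * a ^ j)   ≈⟨ +-congʳ (×-comm-* (n C j) a (a ^ j)) ⟨
    a * (n C j) × a ^ j + (n C suc j) × (a * a ^ j)     ∎

  evenBinomialSum oddBinomialSum : ℕ → Carrier → Carrier
  evenBinomialSum n a = ∑≤ n (λ k → binomialTerm n (2 ℕ.* k) a)
  oddBinomialSum  n a = ∑≤ n (λ k → binomialTerm n (suc (2 ℕ.* k)) a)

  evenBinomialSum-truncate : ∀ n a →
    evenBinomialSum n a ≈ ∑≤ (n / 2) (λ k → binomialTerm n (2 ℕ.* k) a)
  evenBinomialSum-truncate n a = ∑≤-vanishing-tail _ (ℕ.≤⇒≤′ (m/n≤m n 2))
    (λ k n/2<k → binomialTerm-vanishes a (half<⇒<double n/2<k))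

  ∑≤-binomialTerm-extend : ∀ n (g : ℕ → ℕ) a → (∀ k → k ℕ.≤ g k) →
    ∑≤ (suc n) (λ k → binomialTerm n (g k) a) ≈ ∑≤ n (λ k → binomialTerm n (g k) a)
  ∑≤-binomialTerm-extend n g a k≤gk = ∑≤-vanishing-tail _ (ℕ.≤′-step ℕ.≤′-refl)
    (λ k n<k → binomialTerm-vanishes a (ℕ.<-≤-trans n<k (k≤gk k)))

  k≤2k : ∀ k → k ℕ.≤ 2 ℕ.* k
  k≤2k k = ℕ.m≤n*m k 2

  k≤1+2k : ∀ k → k ℕ.≤ suc (2 ℕ.* k)
  k≤1+2k k = ℕ.m≤n⇒m≤1+n (k≤2k k)

  oddBinomialSum-suc : ∀ n a → oddBinomialSum (suc n) a ≈ a * evenBinomialSum n a + oddBinomialSum n a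
  oddBinomialSum-suc n a = begin
    ∑≤ (suc n) (λ k → binomialTerm (suc n) (suc (2 ℕ.* k)) a)
      ≈⟨ ∑≤-cong (suc n) (λ k → binomialTerm-pascal n (2 ℕ.* k) a) ⟩
    ∑≤ (suc n) (λ k → a * even k + odd k)
      ≈⟨ ∑≤-distrib-+ (suc n) _ _ ⟩
    ∑≤ (suc n) (λ k → a * even k) + ∑≤ (suc n) odd
      ≈⟨ +-cong (sym (*-distribˡ-∑≤ (suc n) a even)) (∑≤-binomialTerm-extend n _ a k≤1+2k) ⟩
    a * ∑≤ (suc n) even + oddBinomialSum n a
      ≈⟨ +-congʳ (*-congˡ (∑≤-binomialTerm-extend n _ a k≤2k)) ⟩
    a * evenBinomialSum n a + oddBinomialSum n a ∎
    where
    even odd : ℕ → Carrier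
    even k = binomialTerm n (2 ℕ.* k) a
    odd  k = binomialTerm n (suc (2 ℕ.* k)) a

  evenBinomialSum-suc : ∀ n a → evenBinomialSum (suc n) a ≈ evenBinomialSum n a + a * oddBinomialSum n a
  evenBinomialSum-suc n a = begin
    ∑≤ (suc n) (λ k → binomialTerm (suc n) (2 ℕ.* k) a)
      ≈⟨ ∑≤-suc-head n _ ⟩
    even 0 + ∑≤ n (λ k → binomialTerm (suc n) (2 ℕ.* suc k) a)
      ≈⟨ +-congˡ (∑≤-cong n pascal-even) ⟩
    even 0 + ∑≤ n (λ k → a * odd k + even (suc k))
      ≈⟨ +-congˡ (trans (∑≤-distrib-+ n _ _) (+-comm _ _)) ⟩
    even 0 + (∑≤ n (even ∘ suc) + ∑≤ n (λ k → a * odd k))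
      ≈⟨ +-assoc _ _ _ ⟨
    (even 0 + ∑≤ n (even ∘ suc)) + ∑≤ n (λ k → a * odd k)
      ≈⟨ +-congʳ (∑≤-suc-head n even) ⟨
    ∑≤ (suc n) even + ∑≤ n (λ k → a * odd k)
      ≈⟨ +-cong (∑≤-binomialTerm-extend n _ a k≤2k) (sym (*-distribˡ-∑≤ n a odd)) ⟩
    evenBinomialSum n a + a * oddBinomialSum n a ∎
    where
    even odd : ℕ → Carrier
    even k = binomialTerm n (2 ℕ.* k) a
    odd  k = binomialTerm n (suc (2 ℕ.* k)) a
    pascal-even : ∀ k → binomialTerm (suc n) (2 ℕ.* suc k) a ≈ a * odd k + even (suc k)
    pascal-even k = ≡.subst (λ j → binomialTerm (suc n) j a ≈ a * odd k + binomialTerm n j a)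
      (≡.sym (ℕ.*-suc 2 k)) (binomialTerm-pascal n (suc (2 ℕ.* k)) a)

  [1+a]^n≈even+odd : ∀ n a → (1# + a) ^ n ≈ evenBinomialSum n a + oddBinomialSum n a
  [1+a]^n≈even+odd zero    a = sym (trans (+-identityʳ _) (+-identityʳ 1#))
  [1+a]^n≈even+odd (suc n) a = begin
    (1# + a) * (1# + a) ^ n                        ≈⟨ *-congˡ ([1+a]^n≈even+odd n a) ⟩
    (1# + a) * (e + o)                             ≈⟨ distribʳ (e + o) 1# a ⟩
    1# * (e + o) + a * (e + o)                     ≈⟨ +-cong (*-identityˡ (e + o)) (distribˡ a e o) ⟩
    (e + o) + (a * e + a * o)                      ≈⟨ +-congˡ (+-comm (a * e) (a * o)) ⟩
    (e + o) + (a * o + a * e)                      ≈⟨ interchange e o (a * o) (a * e) ⟩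
    (e + a * o) + (o + a * e)                      ≈⟨ +-congˡ (+-comm o (a * e)) ⟩
    (e + a * o) + (a * e + o)                      ≈⟨ +-cong (evenBinomialSum-suc n a) (oddBinomialSum-suc n a) ⟨
    evenBinomialSum (suc n) a + oddBinomialSum (suc n) a ∎
    where
    e = evenBinomialSum n a
    o = oddBinomialSum n a

  [1-a]^n≈even-odd : ∀ n a → (1# - a) ^ n ≈ evenBinomialSum n a - oddBinomialSum n a
  [1-a]^n≈even-odd zero    a = sym (trans (+-congˡ ε⁻¹≈ε) (trans (+-identityʳ _) (+-identityʳ 1#)))
  [1-a]^n≈even-odd (suc n) a = begin
    (1# - a) * (1# - a) ^ n                        ≈⟨ *-congˡ ([1-a]^n≈even-odd n a) ⟩
    (1# - a) * (e - o)                             ≈⟨ [y-z]x≈yx-zx (e - o) 1# a ⟩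
    1# * (e - o) - a * (e - o)                     ≈⟨ +-cong (*-identityˡ (e - o)) (-‿cong (x[y-z]≈xy-xz a e o)) ⟩
    (e - o) - (a * e - a * o)                      ≈⟨ +-congˡ (⁻¹-anti-homo‿- (a * e) (a * o)) ⟩
    (e - o) + (a * o - a * e)                      ≈⟨ interchange e (- o) (a * o) (- (a * e)) ⟩
    (e + a * o) + (- o - a * e)                    ≈⟨ +-congˡ (⁻¹-∙-comm o (a * e)) ⟩
    (e + a * o) - (o + a * e)                      ≈⟨ +-congˡ (-‿cong (+-comm o (a * e))) ⟩
    (e + a * o) - (a * e + o)                      ≈⟨ +-cong (evenBinomialSum-suc n a) (-‿cong (oddBinomialSum-suc n a)) ⟨
    evenBinomialSum (suc n) a - oddBinomialSum (suc n) a ∎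
    where
    e = evenBinomialSum n a
    o = oddBinomialSum n a

  [1+a]^n+[1-a]^n≈even+even : ∀ n a → (1# + a) ^ n + (1# - a) ^ n ≈ evenBinomialSum n a + evenBinomialSum n a
  [1+a]^n+[1-a]^n≈even+even n a = begin
    (1# + a) ^ n + (1# - a) ^ n  ≈⟨ +-cong ([1+a]^n≈even+odd n a) ([1-a]^n≈even-odd n a) ⟩
    (e + o) + (e - o)            ≈⟨ interchange e o e (- o) ⟩
    (e + e) + (o - o)            ≈⟨ +-congˡ (-‿inverseʳ o) ⟩
    (e + e) + 0#                 ≈⟨ +-identityʳ (e + e) ⟩
    e + e                        ∎
    where
    e = evenBinomialSum n a
    o = oddBinomialSum n a

open import Data.Integer using (ℤ; +_; -[1+_]; _+_; _*_; -_; _^_)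
open import Data.Integer.Tactic.RingSolver using (solve-∀)
import Data.Integer.Properties as ℤ
open import Data.Product using (_×_)
open import Relation.Binary.PropositionalEquality using (_≡_; refl; sym; trans; cong; cong₂; module ≡-Reasoning)
open import Defs

infixl 6 _+φ_ _+ᵩ_
infixl 7 _*ᵩ_

-- p +φ q stands for p + q φ, where φ² = φ + 1.
record ℤ[φ] : Set where
  constructor _+φ_
  field
    re im : ℤ

_+ᵩ_ : ℤ[φ] → ℤ[φ] → ℤ[φ]
(a +φ b) +ᵩ (c +φ d) = (a + c) +φ (b + d)

_*ᵩ_ : ℤ[φ] → ℤ[φ] → ℤ[φ]
(a +φ b) *ᵩ (c +φ d) = (a * c + b * d) +φ (a * d + b * c + b * d)

-ᵩ_ : ℤ[φ] → ℤ[φ]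
-ᵩ (a +φ b) = (- a) +φ (- b)

0ᵩ 1ᵩ φ : ℤ[φ]
0ᵩ = + 0 +φ + 0
1ᵩ = + 1 +φ + 0
φ  = + 0 +φ + 1

ι : ℤ → ℤ[φ]
ι c = c +φ + 0

open import Algebra.Definitions {A = ℤ[φ]} _≡_
  using (Associative; Commutative; Identity; Inverse; _DistributesOver_)

+ᵩ-assoc : Associative _+ᵩ_
+ᵩ-assoc (a +φ b) (c +φ d) (e +φ f) = cong₂ _+φ_ (ℤ.+-assoc a c e) (ℤ.+-assoc b d f)

+ᵩ-comm : Commutative _+ᵩ_
+ᵩ-comm (a +φ b) (c +φ d) = cong₂ _+φ_ (ℤ.+-comm a c) (ℤ.+-comm b d)

+ᵩ-identity : Identity 0ᵩ _+ᵩ_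
+ᵩ-identity = (λ (a +φ b) → cong₂ _+φ_ (ℤ.+-identityˡ a) (ℤ.+-identityˡ b))
            , (λ (a +φ b) → cong₂ _+φ_ (ℤ.+-identityʳ a) (ℤ.+-identityʳ b))

-ᵩ-inverse : Inverse 0ᵩ -ᵩ_ _+ᵩ_
-ᵩ-inverse = (λ (a +φ b) → cong₂ _+φ_ (ℤ.+-inverseˡ a) (ℤ.+-inverseˡ b))
           , (λ (a +φ b) → cong₂ _+φ_ (ℤ.+-inverseʳ a) (ℤ.+-inverseʳ b))

*ᵩ-assoc : Associative _*ᵩ_
*ᵩ-assoc (a +φ b) (c +φ d) (e +φ f) = cong₂ _+φ_ (re a b c d e f) (im a b c d e f)
  where
  re : ∀ a b c d e f → (a * c + b * d) * e + (a * d + b * c + b * d) * f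
                     ≡ a * (c * e + d * f) + b * (c * f + d * e + d * f)
  re = solve-∀
  im : ∀ a b c d e f → (a * c + b * d) * f + (a * d + b * c + b * d) * e + (a * d + b * c + b * d) * f
                     ≡ a * (c * f + d * e + d * f) + b * (c * e + d * f) + b * (c * f + d * e + d * f)
  im = solve-∀

*ᵩ-identity : Identity 1ᵩ _*ᵩ_
*ᵩ-identity = (λ (a +φ b) → cong₂ _+φ_ (reˡ a b) (imˡ a b)) , (λ (a +φ b) → cong₂ _+φ_ (reʳ a b) (imʳ a b))
  where
  reˡ : ∀ a b → + 1 * a + + 0 * b ≡ a
  reˡ = solve-∀
  imˡ : ∀ a b → + 1 * b + + 0 * a + + 0 * b ≡ b
  imˡ = solve-∀
  reʳ : ∀ a b → a * + 1 + b * + 0 ≡ a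
  reʳ = solve-∀
  imʳ : ∀ a b → a * + 0 + b * + 1 + b * + 0 ≡ b
  imʳ = solve-∀

*ᵩ-distrib-+ᵩ : _*ᵩ_ DistributesOver _+ᵩ_
*ᵩ-distrib-+ᵩ = (λ (a +φ b) (c +φ d) (e +φ f) → cong₂ _+φ_ (reˡ a b c d e f) (imˡ a b c d e f))
              , (λ (a +φ b) (c +φ d) (e +φ f) → cong₂ _+φ_ (reʳ a b c d e f) (imʳ a b c d e f))
  where
  reˡ : ∀ a b c d e f → a * (c + e) + b * (d + f) ≡ a * c + b * d + (a * e + b * f)
  reˡ = solve-∀
  imˡ : ∀ a b c d e f → a * (d + f) + b * (c + e) + b * (d + f) ≡ a * d + b * c + b * d + (a * f + b * e + b * f)
  imˡ = solve-∀
  reʳ : ∀ a b c d e f → (c + e) * a + (d + f) * b ≡ c * a + d * b + (e * a + f * b)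
  reʳ = solve-∀
  imʳ : ∀ a b c d e f → (c + e) * b + (d + f) * a + (d + f) * b ≡ c * b + d * a + d * b + (e * b + f * a + f * b)
  imʳ = solve-∀

ℤ[φ]-ring : Ring 0ℓ 0ℓ
ℤ[φ]-ring = record
  { isRing = record
    { +-isAbelianGroup = record
      { isGroup = record
        { isMonoid = record
          { isSemigroup = record
            { isMagma = record { isEquivalence = ≡.isEquivalence ; ∙-cong = cong₂ _+ᵩ_ }
            ; assoc = +ᵩ-assoc
            }
          ; identity = +ᵩ-identity
          }
        ; inverse = -ᵩ-inverse
        ; ⁻¹-cong = cong -ᵩ_
        }
      ; comm = +ᵩ-comm
      }
    ; *-cong = cong₂ _*ᵩ_
    ; *-assoc = *ᵩ-assoc
    ; *-identity = *ᵩ-identity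
    ; distrib = *ᵩ-distrib-+ᵩ
    }
  }

open BinomialParity ℤ[φ]-ring
  using (∑≤; binomialTerm; evenBinomialSum; evenBinomialSum-truncate; [1+a]^n+[1-a]^n≈even+even)
open import Algebra.Definitions.RawMonoid (Ring.+-rawMonoid ℤ[φ]-ring) using () renaming (_×_ to _×ᵩ_)
open import Algebra.Properties.Semiring.Exp (Ring.semiring ℤ[φ]-ring) using (^-assocʳ) renaming (_^_ to _^ᵩ_)

FibonacciRecurrence : (ℤ → ℤ) → Set
FibonacciRecurrence G = ∀ m → G (m + + 2) ≡ G (m + + 1) + G m

infix 5 _·_

_·_ : ℤ[φ] → (ℤ → ℤ) → ℤ → ℤ
((p +φ q) · G) s = p * G s + q * G (s + + 1)

module _ (G : ℤ → ℤ) where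

  ·-+ᵩ : ∀ x y s → ((x +ᵩ y) · G) s ≡ (x · G) s + (y · G) s
  ·-+ᵩ (a +φ b) (c +φ d) s = lemma a b c d (G s) (G (s + + 1))
    where
    lemma : ∀ a b c d u v → (a + c) * u + (b + d) * v ≡ (a * u + b * v) + (c * u + d * v)
    lemma = solve-∀

  ·-×ᵩ : ∀ m x s → ((m ×ᵩ x) · G) s ≡ + m * (x · G) s
  ·-×ᵩ zero    x s = lemma (G s) (G (s + + 1)) ((x · G) s)
    where
    lemma : ∀ u v w → + 0 * u + + 0 * v ≡ + 0 * w
    lemma = solve-∀
  ·-×ᵩ (suc m) x s = begin
    ((x +ᵩ m ×ᵩ x) · G) s          ≡⟨ ·-+ᵩ x (m ×ᵩ x) s ⟩
    (x · G) s + ((m ×ᵩ x) · G) s   ≡⟨ cong (_+_ ((x · G) s)) (·-×ᵩ m x s) ⟩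
    (x · G) s + + m * (x · G) s    ≡⟨ ℤ.suc-* (+ m) ((x · G) s) ⟨
    + suc m * (x · G) s            ∎
    where open ≡-Reasoning

  ·-ι : ∀ c x s → ((ι c *ᵩ x) · G) s ≡ c * (x · G) s
  ·-ι c (a +φ b) s = lemma c a b (G s) (G (s + + 1))
    where
    lemma : ∀ c a b u v → (c * a + + 0 * b) * u + (c * b + + 0 * a + + 0 * b) * v ≡ c * (a * u + b * v)
    lemma = solve-∀

  ·-∑≤ : ∀ m f {g : ℕ → ℤ} s → (∀ k → (f k · G) s ≡ g k) → (∑≤ m f · G) s ≡ sumTo m g
  ·-∑≤ zero    f s f≡g = f≡g zero
  ·-∑≤ (suc m) f s f≡g = trans (·-+ᵩ (∑≤ m f) (f (suc m)) s) (cong₂ _+_ (·-∑≤ m f s f≡g) (f≡g (suc m)))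

^-distribʳ-* : ∀ i j n → (i * j) ^ n ≡ i ^ n * j ^ n
^-distribʳ-* i j zero    = refl
^-distribʳ-* i j (suc n) = trans (cong ((i * j) *_) (^-distribʳ-* i j n)) (lemma i j (i ^ n) (j ^ n))
  where
  lemma : ∀ i j x y → i * j * (x * y) ≡ i * x * (j * y)
  lemma = solve-∀

-- √5 = 2φ - 1, so √5 φ³ = (2φ - 1)(2φ + 1) = 4φ + 3.
√5φ³ : ℤ[φ]
√5φ³ = + 3 +φ + 4

√5φ³-squared : √5φ³ ^ᵩ 2 ≡ ι (+ 5) *ᵩ φ ^ᵩ 6
√5φ³-squared = refl

1+√5φ³ : 1ᵩ +ᵩ √5φ³ ≡ ι (+ 2 * + 2) *ᵩ φ ^ᵩ 2
1+√5φ³ = refl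

1-√5φ³ : 1ᵩ +ᵩ -ᵩ √5φ³ ≡ ι ((- + 1) * + 2) *ᵩ φ ^ᵩ 3
1-√5φ³ = refl

module _ {G : ℤ → ℤ} (rec : FibonacciRecurrence G) where

  ·-φ : ∀ x s → ((φ *ᵩ x) · G) s ≡ (x · G) (s + + 1)
  ·-φ (a +φ b) s = begin
    (+ 0 * a + + 1 * b) * G s + (+ 0 * b + + 1 * a + + 1 * b) * G (s + + 1)
      ≡⟨ lemma a b (G s) (G (s + + 1)) ⟩
    a * G (s + + 1) + b * (G (s + + 1) + G s)
      ≡⟨ cong (λ t → a * G (s + + 1) + b * t) (rec s) ⟨
    a * G (s + + 1) + b * G (s + + 2)
      ≡⟨ cong (λ t → a * G (s + + 1) + b * G t) (ℤ.+-assoc s (+ 1) (+ 1)) ⟨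
    a * G (s + + 1) + b * G (s + + 1 + + 1) ∎
    where
    open ≡-Reasoning
    lemma : ∀ a b u v → (+ 0 * a + + 1 * b) * u + (+ 0 * b + + 1 * a + + 1 * b) * v ≡ a * v + b * (v + u)
    lemma = solve-∀

  ·-φ^ : ∀ m x s → ((φ ^ᵩ m *ᵩ x) · G) s ≡ (x · G) (s + + m)
  ·-φ^ zero    x s = cong₂ (λ y t → (y · G) t) (proj₁ *ᵩ-identity x) (sym (ℤ.+-identityʳ s))
  ·-φ^ (suc m) x s = begin
    ((φ *ᵩ φ ^ᵩ m *ᵩ x) · G) s        ≡⟨ cong (λ y → (y · G) s) (*ᵩ-assoc φ (φ ^ᵩ m) x) ⟩
    ((φ *ᵩ (φ ^ᵩ m *ᵩ x)) · G) s      ≡⟨ ·-φ (φ ^ᵩ m *ᵩ x) s ⟩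
    ((φ ^ᵩ m *ᵩ x) · G) (s + + 1)     ≡⟨ ·-φ^ m x (s + + 1) ⟩
    (x · G) (s + + 1 + + m)           ≡⟨ cong (x · G) (ℤ.+-assoc s (+ 1) (+ m)) ⟩
    (x · G) (s + + suc m)             ∎
    where open ≡-Reasoning

  ·-geometric : ∀ c m k s → (((ι c *ᵩ φ ^ᵩ m) ^ᵩ k) · G) s ≡ c ^ k * G (+ (m ℕ.* k) + s)
  ·-geometric c m zero    s = begin
    + 1 * G s + + 0 * G (s + + 1)   ≡⟨ lemma (G s) (G (s + + 1)) ⟩
    + 1 * G s                       ≡⟨ cong (λ t → + 1 * G t) (ℤ.+-identityˡ s) ⟨
    + 1 * G (+ 0 + s)               ≡⟨ cong (λ j → + 1 * G (+ j + s)) (ℕ.*-zeroʳ m) ⟨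
    + 1 * G (+ (m ℕ.* 0) + s)       ∎
    where
    open ≡-Reasoning
    lemma : ∀ u v → + 1 * u + + 0 * v ≡ + 1 * u
    lemma = solve-∀
  ·-geometric c m (suc k) s = begin
    ((ι c *ᵩ φ ^ᵩ m *ᵩ x) · G) s            ≡⟨ cong (λ y → (y · G) s) (*ᵩ-assoc (ι c) (φ ^ᵩ m) x) ⟩
    ((ι c *ᵩ (φ ^ᵩ m *ᵩ x)) · G) s          ≡⟨ ·-ι G c (φ ^ᵩ m *ᵩ x) s ⟩
    c * ((φ ^ᵩ m *ᵩ x) · G) s               ≡⟨ cong (c *_) (·-φ^ m x s) ⟩
    c * (x · G) (s + + m)                   ≡⟨ cong (c *_) (·-geometric c m k (s + + m)) ⟩
    c * (c ^ k * G (+ (m ℕ.* k) + (s + + m))) ≡⟨ cong (λ t → c * (c ^ k * G t)) index ⟩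
    c * (c ^ k * G (+ (m ℕ.* suc k) + s))   ≡⟨ ℤ.*-assoc c (c ^ k) _ ⟨
    c ^ suc k * G (+ (m ℕ.* suc k) + s)     ∎
    where
    open ≡-Reasoning
    x = (ι c *ᵩ φ ^ᵩ m) ^ᵩ k
    index : + (m ℕ.* k) + (s + + m) ≡ + (m ℕ.* suc k) + s
    index = begin
      + (m ℕ.* k) + (s + + m)   ≡⟨ lemma (+ (m ℕ.* k)) (+ m) s ⟩
      (+ m + + (m ℕ.* k)) + s   ≡⟨ cong (_+ s) (ℤ.pos-+ m (m ℕ.* k)) ⟨
      + (m ℕ.+ m ℕ.* k) + s     ≡⟨ cong (λ j → + j + s) (ℕ.*-suc m k) ⟨
      + (m ℕ.* suc k) + s       ∎
      where
      lemma : ∀ x y s → x + (s + y) ≡ (y + x) + s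
      lemma = solve-∀

  ·-binomialTerm-√5φ³ : ∀ n s k →
    (binomialTerm n (2 ℕ.* k) √5φ³ · G) s ≡ + (n C (2 ℕ.* k)) * (+ 5) ^ k * G (+ (6 ℕ.* k) + s)
  ·-binomialTerm-√5φ³ n s k = begin
    (((n C (2 ℕ.* k)) ×ᵩ √5φ³ ^ᵩ (2 ℕ.* k)) · G) s
      ≡⟨ ·-×ᵩ G (n C (2 ℕ.* k)) _ s ⟩
    + (n C (2 ℕ.* k)) * ((√5φ³ ^ᵩ (2 ℕ.* k)) · G) s
      ≡⟨ cong (λ y → + (n C (2 ℕ.* k)) * (y · G) s) (^-assocʳ √5φ³ 2 k) ⟨
    + (n C (2 ℕ.* k)) * (((√5φ³ ^ᵩ 2) ^ᵩ k) · G) s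
      ≡⟨ cong (λ y → + (n C (2 ℕ.* k)) * ((y ^ᵩ k) · G) s) √5φ³-squared ⟩
    + (n C (2 ℕ.* k)) * (((ι (+ 5) *ᵩ φ ^ᵩ 6) ^ᵩ k) · G) s
      ≡⟨ cong (+ (n C (2 ℕ.* k)) *_) (·-geometric (+ 5) 6 k s) ⟩
    + (n C (2 ℕ.* k)) * ((+ 5) ^ k * G (+ (6 ℕ.* k) + s))
      ≡⟨ ℤ.*-assoc (+ (n C (2 ℕ.* k))) _ _ ⟨
    + (n C (2 ℕ.* k)) * (+ 5) ^ k * G (+ (6 ℕ.* k) + s) ∎
    where open ≡-Reasoning

  evenBinomialSum-identity : ∀ n s →
    (+ 2) * sumTo (n / 2) (λ k → + (n C (2 ℕ.* k)) * ((+ 5) ^ k) * G (+ (6 ℕ.* k) + s))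
      ≡ (+ 2) ^ n * ((+ 2) ^ n * G (+ (2 ℕ.* n) + s) + sgn n * G (+ (3 ℕ.* n) + s))
  evenBinomialSum-identity n s = begin
    + 2 * sumTo (n / 2) (λ k → + (n C (2 ℕ.* k)) * (+ 5) ^ k * G (+ (6 ℕ.* k) + s))
      ≡⟨ cong (+ 2 *_) (·-∑≤ G (n / 2) _ s (·-binomialTerm-√5φ³ n s)) ⟨
    + 2 * (∑≤ (n / 2) (λ k → binomialTerm n (2 ℕ.* k) √5φ³) · G) s
      ≡⟨ cong (λ y → + 2 * (y · G) s) (evenBinomialSum-truncate n √5φ³) ⟨
    + 2 * (e · G) s
      ≡⟨ trans (·-+ᵩ G e e s) (sym (double ((e · G) s))) ⟨
    ((e +ᵩ e) · G) s
      ≡⟨ cong (λ y → (y · G) s) ([1+a]^n+[1-a]^n≈even+even n √5φ³) ⟨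
    (((1ᵩ +ᵩ √5φ³) ^ᵩ n +ᵩ (1ᵩ +ᵩ -ᵩ √5φ³) ^ᵩ n) · G) s
      ≡⟨ cong₂ (λ u v → ((u ^ᵩ n +ᵩ v ^ᵩ n) · G) s) 1+√5φ³ 1-√5φ³ ⟩
    (((ι (+ 2 * + 2) *ᵩ φ ^ᵩ 2) ^ᵩ n +ᵩ (ι ((- + 1) * + 2) *ᵩ φ ^ᵩ 3) ^ᵩ n) · G) s
      ≡⟨ ·-+ᵩ G ((ι (+ 2 * + 2) *ᵩ φ ^ᵩ 2) ^ᵩ n) ((ι ((- + 1) * + 2) *ᵩ φ ^ᵩ 3) ^ᵩ n) s ⟩
    ((ι (+ 2 * + 2) *ᵩ φ ^ᵩ 2) ^ᵩ n · G) s + ((ι ((- + 1) * + 2) *ᵩ φ ^ᵩ 3) ^ᵩ n · G) s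
      ≡⟨ cong₂ _+_ (·-geometric _ 2 n s) (·-geometric _ 3 n s) ⟩
    (+ 2 * + 2) ^ n * G₂ + ((- + 1) * + 2) ^ n * G₃
      ≡⟨ cong₂ (λ p q → p * G₂ + q * G₃) (^-distribʳ-* (+ 2) (+ 2) n) (^-distribʳ-* (- + 1) (+ 2) n) ⟩
    (+ 2) ^ n * (+ 2) ^ n * G₂ + sgn n * (+ 2) ^ n * G₃
      ≡⟨ factor ((+ 2) ^ n) (sgn n) G₂ G₃ ⟩
    (+ 2) ^ n * ((+ 2) ^ n * G₂ + sgn n * G₃) ∎
    where
    open ≡-Reasoning
    e = evenBinomialSum n √5φ³
    G₂ = G (+ (2 ℕ.* n) + s)
    G₃ = G (+ (3 ℕ.* n) + s)
    double : ∀ w → + 2 * w ≡ w + w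
    double = solve-∀
    factor : ∀ p ε x y → p * p * x + ε * p * y ≡ p * (p * x + ε * y)
    factor = solve-∀

F-recurrence : FibonacciRecurrence F
F-recurrence (+ n) rewrite ℕ.+-comm n 2 | ℕ.+-comm n 1 = refl
F-recurrence -[1+ 0 ] = refl
F-recurrence -[1+ 1 ] = refl
F-recurrence -[1+ suc (suc n) ] = lemma (sgn n) (fibℕ (suc n)) (fibℕ n)
  where
  lemma : ∀ ε x y → ε * x ≡ ((- + 1) * ε) * (x + y) + ((- + 1) * ((- + 1) * ε)) * ((x + y) + x)
  lemma = solve-∀

L-recurrence : FibonacciRecurrence L
L-recurrence (+ n) rewrite ℕ.+-comm n 2 | ℕ.+-comm n 1 = refl
L-recurrence -[1+ 0 ] = refl
L-recurrence -[1+ 1 ] = refl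
L-recurrence -[1+ suc (suc n) ] = lemma (sgn n) (lucℕ (suc n)) (lucℕ n)
  where
  lemma : ∀ ε x y → (- + 1) * ε * x
                  ≡ ((- + 1) * ((- + 1) * ε)) * (x + y) + ((- + 1) * ((- + 1) * ((- + 1) * ε))) * ((x + y) + x)
  lemma = solve-∀

theorem8 : (n : ℕ) (s : ℤ) →
    ((+ 2) * sumTo (n / 2) (λ k → + (n C (2 ℕ.* k)) * ((+ 5) ^ k) * F (+ (6 ℕ.* k) + s))
    ≡ (+ 2) ^ n * ((+ 2) ^ n * F (+ (2 ℕ.* n) + s) + sgn n * F (+ (3 ℕ.* n) + s)))
    × ((+ 2) * sumTo (n / 2) (λ k → + (n C (2 ℕ.* k)) * ((+ 5) ^ k) * L (+ (6 ℕ.* k) + s))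
    ≡ (+ 2) ^ n * ((+ 2) ^ n * L (+ (2 ℕ.* n) + s) + sgn n * L (+ (3 ℕ.* n) + s)))
theorem8 n s = evenBinomialSum-identity {F} F-recurrence n s , evenBinomialSum-identity {L} L-recurrence n s
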